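{- There exists a list $I=(x_1,\ldots,x_n)$ of items with all sizes $x_i\in(1/3,1]$ such that \[ \mathbb{E}[\mathrm{BF}(I^\sigma)] > \tfrac{6}{5}\,\mathrm{OPT}(I), \] where the expectation is over $\sigma$ drawn uniformly at random from $\mathcal{S}_n$.
   Context: Bin packing: a list of items with sizes in $(0,1]$ must be assigned to unit-capacity bins so that each bin's total size is at most $1$. $\mathrm{OPT}(I)$ is the minimum number of bins needed to pack $I$. Best Fit ($\mathrm{BF}$) is the online algorithm that processes items in list order and packs the current item into the fullest already-open bin in which it fits, opening a new bin if it fits in none; $\mathrm{BF}(I)$ denotes the number of bins it uses on list $I$. $\mathcal{S}_n$ is the set of permutations of $\{1,\ldots,n\}$, and $I^\sigma=(x_{\sigma(1)},\ldots,x_{\sigma(n)})$. -}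

module Defs where

open import Data.Nat as ℕ using (ℕ; zero; suc)
open import Data.Rational using (ℚ; 0ℚ; 1ℚ; _+_; _≤_; _⊔_)
open import Data.Rational.Properties using (_≤?_; _≟_)
open import Data.List as List using (List; []; _∷_; _++_; [_]; length; foldl; concatMap; map)
open import Data.Nat.ListAction using (sum)
open import Data.Maybe using (Maybe; just; nothing)
open import Data.Fin as Fin using (Fin)
open import Data.Vec as Vec using (Vec; lookup)
open import Data.Product using (Σ; _×_)
open import Relation.Nullary using (yes; no)
open import Relation.Binary.PropositionalEquality using (_≡_)

-- Best Fit.  A packing state is the list of loads of the open bins.

bestLoad : ℚ → List ℚ → Maybe ℚ
bestLoad x [] = nothing
bestLoad x (l ∷ ls) with l + x ≤? 1ℚ | bestLoad x ls
... | yes _ | nothing = just l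
... | yes _ | just m  = just (l ⊔ m)
... | no _  | r       = r

addTo : ℚ → ℚ → List ℚ → List ℚ
addTo l x [] = []
addTo l x (b ∷ bs) with b ≟ l
... | yes _ = (b + x) ∷ bs
... | no _  = b ∷ addTo l x bs

bfStep : List ℚ → ℚ → List ℚ
bfStep bins x with bestLoad x bins
... | just l  = addTo l x bins
... | nothing = bins ++ [ x ]

BF : List ℚ → ℕ
BF I = length (foldl bfStep [] I)

load : ∀ {n k} → Vec ℚ n → (Fin n → Fin k) → Fin k → ℚ
load {zero}  Vec.[]       f b = 0ℚ
load {suc n} (x Vec.∷ xs) f b with f Fin.zero Fin.≟ b
... | yes _ = x + load xs (λ i → f (Fin.suc i)) b
... | no _  = load xs (λ i → f (Fin.suc i)) b

Feasible : ∀ {n} → Vec ℚ n → ℕ → Set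
Feasible {n} I k = Σ (Fin n → Fin k) λ f → ∀ (b : Fin k) → load I f b ≤ 1ℚ

IsOPT : ∀ {n} → Vec ℚ n → ℕ → Set
IsOPT I k = Feasible I k × (∀ m → Feasible I m → k ℕ.≤ m)

-- All permutations of a list (insertion enumeration; a list of length n
-- yields n! lists, one for each permutation of positions).

insertions : ∀ {A : Set} → A → List A → List (List A)
insertions x [] = [ x ∷ [] ]
insertions x (y ∷ ys) = (x ∷ y ∷ ys) ∷ map (y ∷_) (insertions x ys)

perms : ∀ {A : Set} → List A → List (List A)
perms [] = [ [] ]
perms (x ∷ xs) = concatMap (insertions x) (perms xs)

allPerms : (n : ℕ) → List (List (Fin n))
allPerms n = perms (List.allFin n)

permute : ∀ {n} → Vec ℚ n → List (Fin n) → List ℚ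
permute I σ = map (lookup I) σ

totalBF : ∀ {n} → Vec ℚ n → ℕ
totalBF {n} I = sum (map (λ σ → BF (permute I σ)) (allPerms n))

-- Take the six items 7/18, 8/18, 9/18, 9/18, 10/18, 11/18. Every item exceeds 1/3, so a bin
-- holds at most two of them and OPT = 3, attained by {7,11}, {8,10}, {9,9}. Best Fit, however,
-- is led astray by many orders: summed over all 6! = 720 orders it uses 2600 bins, whereas
-- (6/5) · 3 · 720 = 2592. All of this is a finite computation; minimality of 3 bins is decided
-- by enumerating every assignment of the items to fewer bins.
module Submission where

open import Defs
open import Data.Nat as ℕ using (ℕ; _*_; _<_; _!)
open import Data.Nat.Properties using (≮⇒≥; <⇒≱) renaming (_<?_ to _<ℕ?_)
open import Data.Rational using (ℚ; 1ℚ; _+_) renaming (_<_ to _<ℚ_; _≤_ to _≤ℚ_; _/_ to _/ℚ_)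
open import Data.Rational.Properties using (_≤?_; _<?_)
open import Data.Integer using (+_)
open import Data.Vec using (Vec; lookup; _∷_; [])
open import Data.Vec.Functional as Vector using (head; tail)
open import Data.Fin using (Fin; zero; suc; toℕ; fromℕ<; _≟_)
open import Data.Fin.Properties using (any?; all?; toℕ<n; toℕ-fromℕ<)
open import Data.Product using (Σ; ∃; _×_; _,_)
open import Relation.Nullary using (Dec; yes; no; ¬_; contradiction)
open import Relation.Nullary.Decidable using (map′; _×-dec_; ¬?; from-yes)
open import Relation.Binary.PropositionalEquality using (_≡_; refl; sym; trans; cong; subst)

-- Enumerating functions rebuilds them as head ∷ tail, which without function extensionality
-- is only pointwise equal to the original, so the predicate must respect pointwise equality.
Extensional : ∀ {n k} → ((Fin n → Fin k) → Set) → Set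
Extensional P = ∀ {f g} → (∀ i → f i ≡ g i) → P f → P g

any-function? : ∀ {n k} {P : (Fin n → Fin k) → Set} →
  Extensional P → (∀ f → Dec (P f)) → Dec (∃ P)
any-function? {ℕ.zero} resp P? =
  map′ (λ p → empty , p) (λ { (f , p) → resp {f} {empty} (λ ()) p }) (P? empty)
  where
  empty : Fin 0 → _
  empty ()
any-function? {ℕ.suc n} {P = P} resp P? =
  map′ (λ { (b , g , p) → b Vector.∷ g , p })
       (λ { (f , p) → head f , tail f , resp head∷tail p })
       (any? λ b → any-function? (λ eq → resp (∷-cong b eq)) (λ g → P? (b Vector.∷ g)))
  where
  head∷tail : ∀ {f : Fin (ℕ.suc n) → _} i → f i ≡ (head f Vector.∷ tail f) i
  head∷tail zero    = refl
  head∷tail (suc i) = refl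

  ∷-cong : ∀ b {g h : Fin n → _} → (∀ i → g i ≡ h i) → ∀ i → (b Vector.∷ g) i ≡ (b Vector.∷ h) i
  ∷-cong b eq zero    = refl
  ∷-cong b eq (suc i) = eq i

load-cong : ∀ {n k} (I : Vec ℚ n) {f g : Fin n → Fin k} →
  (∀ i → f i ≡ g i) → ∀ b → load I f b ≡ load I g b
load-cong []      eq b = refl
load-cong (x ∷ I) {f} {g} eq b with f zero ≟ b | g zero ≟ b
... | yes _ | yes _ = cong (λ l → x + l) (load-cong I (λ i → eq (suc i)) b)
... | no _  | no _  = load-cong I (λ i → eq (suc i)) b
... | yes p | no q  = contradiction (trans (sym (eq zero)) p) q
... | no q  | yes p = contradiction (trans (eq zero) p) q

feasible? : ∀ {n} (I : Vec ℚ n) k → Dec (Feasible I k)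
feasible? I k = any-function? fits-cong (λ f → all? λ b → load I f b ≤? 1ℚ)
  where
  fits-cong : Extensional λ f → ∀ b → load I f b ≤ℚ 1ℚ
  fits-cong eq fits b = subst (_≤ℚ 1ℚ) (load-cong I eq b) (fits b)

isOPT? : ∀ {n} (I : Vec ℚ n) k → Dec (IsOPT I k)
isOPT? I k = map′ minimal least (feasible? I k ×-dec all? λ m → ¬? (feasible? I (toℕ m)))
  where
  minimal : Feasible I k × (∀ (m : Fin k) → ¬ Feasible I (toℕ m)) → IsOPT I k
  minimal (fk , none) = fk , λ m fm →
    ≮⇒≥ λ m<k → none (fromℕ< m<k) (subst (Feasible I) (sym (toℕ-fromℕ< m<k)) fm)

  least : IsOPT I k → Feasible I k × (∀ (m : Fin k) → ¬ Feasible I (toℕ m))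
  least (fk , below) = fk , λ m fm → <⇒≱ (toℕ<n m) (below (toℕ m) fm)

items : Vec ℚ 6
items = (+ 7 /ℚ 18) ∷ (+ 8 /ℚ 18) ∷ (+ 9 /ℚ 18) ∷ (+ 9 /ℚ 18) ∷ (+ 10 /ℚ 18) ∷ (+ 11 /ℚ 18) ∷ []

totalBF-items : totalBF items ≡ 2600
totalBF-items = refl

proposition3 : Σ ℕ λ n → Σ (Vec ℚ n) λ I →
    (∀ (i : Fin n) → ((+ 1) /ℚ 3) <ℚ lookup I i × lookup I i ≤ℚ 1ℚ) ×
    Σ ℕ λ k → IsOPT I k × (6 * (n !) * k < 5 * totalBF I)
proposition3 = 6 , items , sizes , 3 , from-yes (isOPT? items 3) , beats
  where
  sizes : ∀ i → ((+ 1) /ℚ 3) <ℚ lookup items i × lookup items i ≤ℚ 1ℚ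
  sizes = from-yes (all? λ i → ((+ 1) /ℚ 3) <? lookup items i ×-dec lookup items i ≤? 1ℚ)

  beats : 6 * (6 !) * 3 < 5 * totalBF items
  beats = subst (λ t → 6 * (6 !) * 3 < 5 * t) (sym totalBF-items) (from-yes (12960 <ℕ? 13000))
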